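{- Let $(A,P,B,T,F)$ be a well-formed reversing Petri net, $\langle M,H\rangle$ a state such that every $a\in A$ satisfies $|\{x\in P\mid a\in M(x)\}|=1$, and suppose $\langle M,H\rangle\xrightarrow{t}\langle M',H'\rangle$ is a forward transition. Then (1) for all $a\in A$, $|\{x\in P\mid a\in M'(x)\}|=1$; and (2) for all $\beta\in B$, $|\{x\in P\mid\beta\in M(x)\}|\le|\{x\in P\mid\beta\in M'(x)\}|\le 1$.
   Context: A reversing Petri net is a tuple $(A,P,B,T,F)$: $A$ a finite set of bases (tokens), $\overline A=\{\overline a\mid a\in A\}$; $P$ a finite set of places; $B\subseteq A\times A$ undirected bonds ($(a,b)$ written $a-b$), $\overline B=\{\overline\beta\mid\beta\in B\}$; $T$ a finite set of transitions; $F:(P\times T\cup T\times P)\to 2^{A\cup\overline A\cup B\cup\overline B}$ arc labels, where in each label every token appears at most once (as $a$ or $\overline a$), a bond $a-b$ in a label forces $a,b$ in it, and outgoing labels $F(t,x)$ contain no negative elements. $\circ t=\{x\mid F(x,t)\neq\emptyset\}$, $t\circ=\{x\mid F(t,x)\ne\emptyset\}$, $\mathrm{pre}(t)=\bigcup_xF(x,t)$, $\mathrm{post}(t)=\bigcup_xF(t,x)$. Well-formed: for every $t$, $A\cap\mathrm{pre}(t)=A\cap\mathrm{post}(t)$, every bond in $\mathrm{pre}(t)$ is in $\mathrm{post}(t)$, and $F(t,x)\cap F(t,y)=\emptyset$ for $x\ne y$. A marking is $M:P\to 2^{A\cup B}$ with $a-b\in M(x)\Rightarrow a,b\in M(x)$;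 a history is $H:T\to2^{\mathbb N}$; a state is $\langle M,H\rangle$. $\mathrm{con}(a,C)$, for $a\in A$, $C\subseteq A\cup B$, is $\{a\}\cap C$ together with all bonds $(b,c)$ and their endpoints lying on a chain $\beta_1,\dots,\beta_n$, $\beta_i=(a_{i-1},a_i)\in C\cap B$, $a_i\in C\cap A$, $a_0=a$. $t$ is forward-enabled in $\langle M,H\rangle$ if: (1) for $x\in\circ t$, $a\in F(x,t)\Rightarrow a\in M(x)$ and $\overline a\in F(x,t)\Rightarrow a\notin M(x)$; (2) likewise for bonds; (3) if $a\in F(t,y_1)$, $b\in F(t,y_2)$, $y_1\neq y_2$, then $b\notin\mathrm{con}(a,M(x))$ for all $x\in\circ t$; (4) if $\beta\in F(t,x)$ for some $x\in t\circ$ and $\beta\in M(y)$ for some $y\in\circ t$ then $\beta\in F(y,t)$. For enabled $t$, $\langle M,H\rangle\xrightarrow{t}\langle M',H'\rangle$ where $M'(x)=M(x)-\bigcup_{a\in F(x,t)}\mathrm{con}(a,M(x))$ if $x\in\circ t$, $M'(x)=M(x)\cup F(t,x)\cup\bigcup_{a\in F(t,x)\cap F(y,t)}\mathrm{con}(a,M(y))$ if $x\in t\circ$, $M'(x)=M(x)$ otherwise, and $H'(t)=H(t)\cup\{\max(\{0\}\cup\bigcup_{t''\in T}H(t''))+1\}$, $H'(t')=H(t')$ for $t'\ne t$. -}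

module Defs where

open import Data.Nat using (ℕ; suc; _⊔_)
open import Data.Fin using (Fin)
open import Data.Fin.Subset using (Subset; _∈_; _∉_; ∣_∣)
open import Data.Vec using (tabulate; lookup)
open import Data.List using (List; foldr; concat; map)
open import Data.List.Membership.Propositional using () renaming (_∈_ to _∈ₗ_)
open import Data.Fin using () renaming (Fin to F)
open import Data.List using () renaming (List to L)
open import Data.Fin.Base using ()
open import Data.List.Base using ()
open import Data.Product using (_×_; _,_; proj₁; proj₂; ∃; ∃₂; Σ)
open import Data.Sum using (_⊎_)
open import Relation.Binary.PropositionalEquality using (_≡_; _≢_)
open import Relation.Nullary using (¬_)
open import Function.Bundles using (_⇔_)
import Data.List as List
import Data.Fin as Fin

-- A = Fin nA (bases), P = Fin nP (places), B = Fin nB (bonds),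
-- T = Fin nT (transitions).  Each bond β is an undirected pair of bases
-- given by  ends β  (orientation irrelevant).

-- An arc label: a subset of A ∪ Ā ∪ B ∪ B̄, split into its four parts.
record Label (nA nB : ℕ) : Set where
  constructor label
  field
    pos  : Subset nA
    neg  : Subset nA
    bpos : Subset nB
    bneg : Subset nB
open Label public

record RPN : Set where
  field
    nA nP nB nT : ℕ
    ends : Fin nB → Fin nA × Fin nA
    Fin-arc  : Fin nP → Fin nT → Label nA nB
    Fout-arc : Fin nT → Fin nP → Label nA nB
open RPN public

module _ (N : RPN) where

  Place = Fin (nP N)
  Base  = Fin (nA N)
  Bond  = Fin (nB N)
  Trans = Fin (nT N)

  Orient : Bond → Base → Base → Set
  Orient β u v = ends N β ≡ (u , v) ⊎ ends N β ≡ (v , u)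

  LabelOK : Label (nA N) (nB N) → Set
  LabelOK l = (∀ a → ¬ (a ∈ pos l × a ∈ neg l))
            × (∀ β → ¬ (β ∈ bpos l × β ∈ bneg l))
            × (∀ β → β ∈ bpos l → proj₁ (ends N β) ∈ pos l × proj₂ (ends N β) ∈ pos l)

  NoNeg : Label (nA N) (nB N) → Set
  NoNeg l = (∀ a → a ∉ neg l) × (∀ β → β ∉ bneg l)

  -- the data actually form a reversing Petri net:
  -- B is a *set* of undirected pairs, labels are as required,
  -- outgoing labels contain no negative elements
  IsRPN : Set
  IsRPN = (∀ β γ → Orient β (proj₁ (ends N γ)) (proj₂ (ends N γ)) → β ≡ γ)
        × (∀ x t → LabelOK (Fin-arc N x t))
        × (∀ t x → LabelOK (Fout-arc N t x))
        × (∀ t x → NoNeg (Fout-arc N t x))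

  WellFormed : Set
  WellFormed =
      (∀ t a → (∃ λ x → a ∈ pos (Fin-arc N x t)) ⇔ (∃ λ x → a ∈ pos (Fout-arc N t x)))
    × (∀ t β → (∃ λ x → β ∈ bpos (Fin-arc N x t)) → (∃ λ x → β ∈ bpos (Fout-arc N t x)))
    × (∀ t x y → x ≢ y →
          (∀ a → ¬ (a ∈ pos  (Fout-arc N t x) × a ∈ pos  (Fout-arc N t y)))
        × (∀ a → ¬ (a ∈ neg  (Fout-arc N t x) × a ∈ neg  (Fout-arc N t y)))
        × (∀ β → ¬ (β ∈ bpos (Fout-arc N t x) × β ∈ bpos (Fout-arc N t y)))
        × (∀ β → ¬ (β ∈ bneg (Fout-arc N t x) × β ∈ bneg (Fout-arc N t y))))

  Conf : Set
  Conf = Subset (nA N) × Subset (nB N)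

  Marking : Set
  Marking = Place → Conf

  IsMarking : Marking → Set
  IsMarking M = ∀ x β → β ∈ proj₂ (M x) →
                  proj₁ (ends N β) ∈ proj₁ (M x) × proj₂ (ends N β) ∈ proj₁ (M x)

  -- histories H : T → 2^ℕ (finite sets, represented by lists)
  History : Set
  History = Trans → List ℕ

  maxH : History → ℕ
  maxH H = foldr _⊔_ 0 (concat (map H (List.allFin (nT N))))

  -- chains for con(a, C): Reach C a v  means there is a chain
  -- β₁,…,βₙ (n ≥ 0), βᵢ = (aᵢ₋₁,aᵢ) ∈ C ∩ B, aᵢ ∈ C ∩ A (i ≥ 1), a₀ = a, aₙ = v
  data Reach (C : Conf) (a : Base) : Base → Set where
    start : Reach C a a
    step  : ∀ {u v} (β : Bond) → β ∈ proj₂ C → Orient β u v → v ∈ proj₁ C →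
            Reach C a u → Reach C a v

  -- β ∈ con(a, C): β lies on such a chain
  InConB : Base → Conf → Bond → Set
  InConB a C β = β ∈ proj₂ C ×
    ∃₂ λ u v → Orient β u v × Reach C a u × v ∈ proj₁ C

  -- c ∈ con(a, C): c ∈ {a} ∩ C, or c is an endpoint of a bond in con(a, C)
  InConA : Base → Conf → Base → Set
  InConA a C c = (c ≡ a × a ∈ proj₁ C)
               ⊎ (∃ λ β → InConB a C β × (c ≡ proj₁ (ends N β) ⊎ c ≡ proj₂ (ends N β)))

  InPre : Trans → Place → Set
  InPre t x = (∃ λ a → a ∈ pos l ⊎ a ∈ neg l) ⊎ (∃ λ β → β ∈ bpos l ⊎ β ∈ bneg l)
    where l = Fin-arc N x t

  ForwardEnabled : Marking → Trans → Set
  ForwardEnabled M t =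
      (∀ x a → a ∈ pos (Fin-arc N x t) → a ∈ proj₁ (M x))
    × (∀ x a → a ∈ neg (Fin-arc N x t) → a ∉ proj₁ (M x))
    × (∀ x β → β ∈ bpos (Fin-arc N x t) → β ∈ proj₂ (M x))
    × (∀ x β → β ∈ bneg (Fin-arc N x t) → β ∉ proj₂ (M x))
    × (∀ a b y₁ y₂ → a ∈ pos (Fout-arc N t y₁) → b ∈ pos (Fout-arc N t y₂) → y₁ ≢ y₂ →
         ∀ x → InPre t x → ¬ InConA a (M x) b)
    × (∀ β x y → β ∈ bpos (Fout-arc N t x) → InPre t y → β ∈ proj₂ (M y) →
         β ∈ bpos (Fin-arc N y t))

  -- Since F(x,t) = ∅ for x ∉ ∘t and F(t,x) = ∅ for
  -- x ∉ t∘, the three cases of the paper are the uniform formula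
  -- M'(x) = (M(x) − ⋃_{a∈F(x,t)} con(a,M(x))) ∪ F(t,x) ∪ ⋃_{a∈F(t,x)∩F(y,t)} con(a,M(y)).
  ForwardStep : Marking → History → Trans → Marking → History → Set
  ForwardStep M H t M' H' =
      ForwardEnabled M t
    × (∀ x c → c ∈ proj₁ (M' x) ⇔
         ((c ∈ proj₁ (M x) × ¬ (∃ λ a → a ∈ pos (Fin-arc N x t) × InConA a (M x) c))
          ⊎ c ∈ pos (Fout-arc N t x)
          ⊎ (∃₂ λ a y → a ∈ pos (Fout-arc N t x) × a ∈ pos (Fin-arc N y t) × InConA a (M y) c)))
    × (∀ x β → β ∈ proj₂ (M' x) ⇔
         ((β ∈ proj₂ (M x) × ¬ (∃ λ a → a ∈ pos (Fin-arc N x t) × InConB a (M x) β))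
          ⊎ β ∈ bpos (Fout-arc N t x)
          ⊎ (∃₂ λ a y → a ∈ pos (Fout-arc N t x) × a ∈ pos (Fin-arc N y t) × InConB a (M y) β)))
    × (∀ t' n → n ∈ₗ H' t' ⇔ (n ∈ₗ H t' ⊎ (t' ≡ t × n ≡ suc (maxH H))))

  placesOfBase : Marking → Base → Subset (nP N)
  placesOfBase M a = tabulate λ x → lookup (proj₁ (M x)) a

  placesOfBond : Marking → Bond → Subset (nP N)
  placesOfBond M β = tabulate λ x → lookup (proj₂ (M x)) β

-- Every base c has a unique home place in M.  In M' it is either kept at home,
-- when no component con(a, M(home c)) of an input base a contains it, or carried
-- to an output place together with such a component.  Any component containing c
-- lies in c's home place, so c is never both kept and carried; and if it were
-- carried to two different places, the two carrying components would be linked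
-- through c inside one place, which enabledness condition (3) forbids.  A bond
-- travels with its endpoints, so it inherits "at most one place" from them, and
-- it is never destroyed: it is either kept or carried along with a component.
module Submission where

open import Defs
open import Data.Nat using (ℕ; _≤_; _<_; z≤n; s≤s)
open import Data.Nat.Properties using (≤-trans; ≤-antisym; ≤⇒≯)
open import Data.Fin using (Fin; _≟_)
open import Data.Fin.Subset using (Subset; _∈_; _⊆_; ∣_∣; ⁅_⁆; _-_; Nonempty; Empty)
open import Data.Fin.Subset.Properties
  using (nonempty?; Empty-unique; ∣⊥∣≡0; ∣⁅x⁆∣≡1; x∈⁅x⁆; p⊆q⇒∣p∣≤∣q∣; x∈p∧x≢y⇒x∈p-y; x∈p⇒∣p-x∣<∣p∣)
open import Data.Vec using (tabulate; lookup)
open import Data.Vec.Properties using (lookup∘tabulate; []=⇒lookup; lookup⇒[]=)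
open import Data.Product using (_×_; _,_; proj₁; proj₂; ∃; ∃₂)
open import Data.Sum using (_⊎_; inj₁; inj₂)
import Data.Sum as Sum
open import Function using (_∘_)
open import Function.Bundles using (_⇔_; Equivalence)
open Equivalence using (to; from)
open import Relation.Binary.PropositionalEquality using (_≡_; _≢_; refl; sym; trans; cong; subst)
open import Relation.Nullary using (¬_; Dec; yes; no; contradiction)
open import Relation.Nullary.Decidable using (decidable-stable; ¬¬-excluded-middle)
open import Relation.Nullary.Negation using (¬¬-map)

private
  variable
    m n : ℕ
    x : Fin n
    p q : Subset n

AtMostOne : Subset n → Set
AtMostOne p = ∀ {x y} → x ∈ p → y ∈ p → x ≡ y

atMostOne-⊆ : p ⊆ q → AtMostOne q → AtMostOne p
atMostOne-⊆ p⊆q amo x∈p y∈p = amo (p⊆q x∈p) (p⊆q y∈p)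

x∈p⇒1≤∣p∣ : x ∈ p → 1 ≤ ∣ p ∣
x∈p⇒1≤∣p∣ x∈p = ≤-trans (s≤s z≤n) (x∈p⇒∣p-x∣<∣p∣ x∈p)

Empty⇒∣p∣≡0 : Empty p → ∣ p ∣ ≡ 0
Empty⇒∣p∣≡0 {n} empty = trans (cong ∣_∣ (Empty-unique empty)) (∣⊥∣≡0 n)

atMostOne⇒∣p∣≤1 : AtMostOne p → ∣ p ∣ ≤ 1
atMostOne⇒∣p∣≤1 {p = p} amo with nonempty? p
... | yes (x , x∈p) =
  subst (∣ p ∣ ≤_) (∣⁅x⁆∣≡1 x) (p⊆q⇒∣p∣≤∣q∣ λ y∈p → subst (_∈ ⁅ x ⁆) (amo x∈p y∈p) (x∈⁅x⁆ x))
... | no empty = subst (_≤ 1) (sym (Empty⇒∣p∣≡0 empty)) z≤n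

∣p∣≡1⇒nonempty : ∣ p ∣ ≡ 1 → Nonempty p
∣p∣≡1⇒nonempty {p = p} ∣p∣≡1 with nonempty? p
... | yes nonempty = nonempty
... | no empty = contradiction (trans (sym ∣p∣≡1) (Empty⇒∣p∣≡0 empty)) λ ()

∣p∣≡1⇒atMostOne : ∣ p ∣ ≡ 1 → AtMostOne p
∣p∣≡1⇒atMostOne {p = p} ∣p∣≡1 {x} {y} x∈p y∈p with x ≟ y
... | yes x≡y = x≡y
... | no x≢y = contradiction ∣p-x∣<1 (≤⇒≯ (x∈p⇒1≤∣p∣ (x∈p∧x≢y⇒x∈p-y y∈p (x≢y ∘ sym))))
  where
  ∣p-x∣<1 : ∣ p - x ∣ < 1
  ∣p-x∣<1 = subst (∣ p - x ∣ <_) ∣p∣≡1 (x∈p⇒∣p-x∣<∣p∣ x∈p)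

nonempty∧atMostOne⇒∣p∣≡1 : Nonempty p → AtMostOne p → ∣ p ∣ ≡ 1
nonempty∧atMostOne⇒∣p∣≡1 (_ , x∈p) amo = ≤-antisym (atMostOne⇒∣p∣≤1 amo) (x∈p⇒1≤∣p∣ x∈p)

atMostOne⇒∣p∣≤∣q∣ : AtMostOne p → (∀ {x} → x ∈ p → Nonempty q) → ∣ p ∣ ≤ ∣ q ∣
atMostOne⇒∣p∣≤∣q∣ {p = p} {q = q} amo p⇒q with nonempty? p
... | yes (_ , x∈p) = ≤-trans (atMostOne⇒∣p∣≤1 amo) (x∈p⇒1≤∣p∣ (proj₂ (p⇒q x∈p)))
... | no empty = subst (_≤ ∣ q ∣) (sym (Empty⇒∣p∣≡0 empty)) z≤n

-- Nonempty is decidable, so it may be proved by cases on an undecided proposition.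
nonempty-by-cases : {R : Set} → (Dec R → Nonempty p) → Nonempty p
nonempty-by-cases {p = p} byCases =
  decidable-stable (nonempty? p) (¬¬-map byCases ¬¬-excluded-middle)

module _ (S : Fin m → Subset n) {a : Fin n} {x : Fin m} where

  ∈-tabulate-lookup⁺ : a ∈ S x → x ∈ tabulate (λ y → lookup (S y) a)
  ∈-tabulate-lookup⁺ a∈Sx = lookup⇒[]= x _ (trans (lookup∘tabulate _ x) ([]=⇒lookup a∈Sx))

  ∈-tabulate-lookup⁻ : x ∈ tabulate (λ y → lookup (S y) a) → a ∈ S x
  ∈-tabulate-lookup⁻ x∈ = lookup⇒[]= a (S x) (trans (sym (lookup∘tabulate _ x)) ([]=⇒lookup x∈))

module _ (N : RPN) where

  BondClosed : Conf N → Set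
  BondClosed C = ∀ β → β ∈ proj₂ C → proj₁ (ends N β) ∈ proj₁ C × proj₂ (ends N β) ∈ proj₁ C

  private
    variable
      C : Conf N
      a b c u v : Base N
      β : Bond N

  Orient-end : Orient N β u v → c ≡ proj₁ (ends N β) ⊎ c ≡ proj₂ (ends N β) → c ≡ u ⊎ c ≡ v
  Orient-end (inj₁ e) (inj₁ c≡) = inj₁ (trans c≡ (cong proj₁ e))
  Orient-end (inj₁ e) (inj₂ c≡) = inj₂ (trans c≡ (cong proj₂ e))
  Orient-end (inj₂ e) (inj₁ c≡) = inj₂ (trans c≡ (cong proj₁ e))
  Orient-end (inj₂ e) (inj₂ c≡) = inj₁ (trans c≡ (cong proj₂ e))

  Orient⇒∈ : BondClosed C → β ∈ proj₂ C → Orient N β u v → u ∈ proj₁ C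
  Orient⇒∈ {C = C} closed β∈C (inj₁ e) = subst (_∈ proj₁ C) (cong proj₁ e) (proj₁ (closed _ β∈C))
  Orient⇒∈ {C = C} closed β∈C (inj₂ e) = subst (_∈ proj₁ C) (cong proj₂ e) (proj₂ (closed _ β∈C))

  Reach-trans : Reach N C a b → Reach N C b c → Reach N C a c
  Reach-trans a⇝b start = a⇝b
  Reach-trans a⇝b (step β β∈C o c∈C b⇝u) = step β β∈C o c∈C (Reach-trans a⇝b b⇝u)

  Reach-sym : BondClosed C → Reach N C a c → Reach N C c a
  Reach-sym closed start = start
  Reach-sym closed (step β β∈C o _ a⇝u) =
    Reach-trans (step β β∈C (Sum.swap o) (Orient⇒∈ closed β∈C o) start) (Reach-sym closed a⇝u)

  InConA⇒Reach : InConA N a C c → Reach N C a c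
  InConA⇒Reach (inj₁ (refl , _)) = start
  InConA⇒Reach (inj₂ (β , (β∈C , _ , _ , o , a⇝u , v∈C) , end)) with Orient-end o end
  ... | inj₁ refl = a⇝u
  ... | inj₂ refl = step β β∈C o v∈C a⇝u

  Reach⇒InConA : a ∈ proj₁ C → Reach N C a c → InConA N a C c
  Reach⇒InConA a∈C start = inj₁ (refl , a∈C)
  Reach⇒InConA a∈C (step β β∈C (inj₁ e) c∈C a⇝u) =
    inj₂ (β , (β∈C , _ , _ , inj₁ e , a⇝u , c∈C) , inj₂ (sym (cong proj₂ e)))
  Reach⇒InConA a∈C (step β β∈C (inj₂ e) c∈C a⇝u) =
    inj₂ (β , (β∈C , _ , _ , inj₂ e , a⇝u , c∈C) , inj₁ (sym (cong proj₁ e)))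

  InConA⇒∈ : BondClosed C → InConA N a C c → c ∈ proj₁ C
  InConA⇒∈ closed (inj₁ (refl , a∈C)) = a∈C
  InConA⇒∈ closed (inj₂ (β , (β∈C , _) , inj₁ refl)) = proj₁ (closed β β∈C)
  InConA⇒∈ closed (inj₂ (β , (β∈C , _) , inj₂ refl)) = proj₂ (closed β β∈C)

  InConA-shared : BondClosed C → a ∈ proj₁ C → InConA N a C c → InConA N b C c → InConA N a C b
  InConA-shared closed a∈C a⇝c b⇝c =
    Reach⇒InConA a∈C (Reach-trans (InConA⇒Reach a⇝c) (Reach-sym closed (InConA⇒Reach b⇝c)))

  InConB⇒InConA-start : InConB N a C β → InConA N a C (proj₁ (ends N β))
  InConB⇒InConA-start {β = β} β∈con = inj₂ (β , β∈con , inj₁ refl)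

  InConA-start⇒InConB : BondClosed C → β ∈ proj₂ C →
                        InConA N a C (proj₁ (ends N β)) → InConB N a C β
  InConA-start⇒InConB closed β∈C start∈con =
    β∈C , _ , _ , inj₁ refl , InConA⇒Reach start∈con , proj₂ (closed _ β∈C)

  placesOfBond⊆placesOfBase : (K : Marking N) →
    (∀ {x β} → β ∈ proj₂ (K x) → proj₁ (ends N β) ∈ proj₁ (K x)) →
    placesOfBond N K β ⊆ placesOfBase N K (proj₁ (ends N β))
  placesOfBond⊆placesOfBase K start∈ x∈ =
    ∈-tabulate-lookup⁺ (proj₁ ∘ K) (start∈ (∈-tabulate-lookup⁻ (proj₂ ∘ K) x∈))

  module _ (rpn : IsRPN N) (wf : WellFormed N)
           {M M' : Marking N} {H H' : History N} {t : Trans N}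
           (closed : IsMarking N M) (unique : ∀ a → ∣ placesOfBase N M a ∣ ≡ 1)
           (fire : ForwardStep N M H t M' H') where

    inArc outArc : Place N → Label (nA N) (nB N)
    inArc x = Fin-arc N x t
    outArc x = Fout-arc N t x

    Moved : Place N → Base N → Set
    Moved x c = ∃ λ a → a ∈ pos (inArc x) × InConA N a (M x) c

    Carried : Place N → Base N → Set
    Carried x c = ∃₂ λ a y → a ∈ pos (outArc x) × a ∈ pos (inArc y) × InConA N a (M y) c

    MovedBond : Place N → Bond N → Set
    MovedBond x β = ∃ λ a → a ∈ pos (inArc x) × InConB N a (M x) β

    CarriedBond : Place N → Bond N → Set
    CarriedBond x β = ∃₂ λ a y → a ∈ pos (outArc x) × a ∈ pos (inArc y) × InConB N a (M y) β

    inputs-present : ∀ x a → a ∈ pos (inArc x) → a ∈ proj₁ (M x)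
    inputs-present = proj₁ (proj₁ fire)

    outputs-unlinked : ∀ a b y₁ y₂ → a ∈ pos (outArc y₁) → b ∈ pos (outArc y₂) → y₁ ≢ y₂ →
                       ∀ x → InPre N t x → ¬ InConA N a (M x) b
    outputs-unlinked = proj₁ (proj₂ (proj₂ (proj₂ (proj₂ (proj₁ fire)))))

    base-update : ∀ x c → c ∈ proj₁ (M' x) ⇔
      ((c ∈ proj₁ (M x) × ¬ Moved x c) ⊎ c ∈ pos (outArc x) ⊎ Carried x c)
    base-update = proj₁ (proj₂ fire)

    bond-update : ∀ x β → β ∈ proj₂ (M' x) ⇔
      ((β ∈ proj₂ (M x) × ¬ MovedBond x β) ⊎ β ∈ bpos (outArc x) ⊎ CarriedBond x β)
    bond-update = proj₁ (proj₂ (proj₂ fire))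

    output-bond-start : ∀ x β → β ∈ bpos (outArc x) → proj₁ (ends N β) ∈ pos (outArc x)
    output-bond-start x β = proj₁ ∘ proj₂ (proj₂ (proj₁ (proj₂ (proj₂ rpn)) t x)) β

    output-base : ∀ a → (∃ λ x → a ∈ pos (inArc x)) ⇔ (∃ λ x → a ∈ pos (outArc x))
    output-base = proj₁ wf t

    M-unique : ∀ {a x y} → a ∈ proj₁ (M x) → a ∈ proj₁ (M y) → x ≡ y
    M-unique {a} a∈Mx a∈My =
      ∣p∣≡1⇒atMostOne (unique a) (∈-tabulate-lookup⁺ (proj₁ ∘ M) a∈Mx)
                                 (∈-tabulate-lookup⁺ (proj₁ ∘ M) a∈My)

    placesOfBase-M-nonempty : ∀ a → Nonempty (placesOfBase N M a)
    placesOfBase-M-nonempty a = ∣p∣≡1⇒nonempty {p = placesOfBase N M a} (unique a)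

    home : Base N → Place N
    home a = proj₁ (placesOfBase-M-nonempty a)

    ∈home : ∀ a → a ∈ proj₁ (M (home a))
    ∈home a = ∈-tabulate-lookup⁻ (proj₁ ∘ M) (proj₂ (placesOfBase-M-nonempty a))

    ∈M'⇒kept⊎carried : ∀ {c x} → c ∈ proj₁ (M' x) → (c ∈ proj₁ (M x) × ¬ Moved x c) ⊎ Carried x c
    ∈M'⇒kept⊎carried {c} {x} c∈M'x with to (base-update x c) c∈M'x
    ... | inj₁ kept = inj₁ kept
    ... | inj₂ (inj₂ carried) = inj₂ carried
    -- By well-formedness c is also an input, so it is carried with its own component.
    ... | inj₂ (inj₁ c∈out) with from (output-base c) (x , c∈out)
    ...   | y , c∈in = inj₂ (c , y , c∈out , c∈in , inj₁ (refl , inputs-present y c c∈in))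

    carried⇒moved-from-home : ∀ {c x} → Carried x c → Moved (home c) c
    carried⇒moved-from-home {c} (a , y , _ , a∈in , c∈con)
      with M-unique (InConA⇒∈ (closed y) c∈con) (∈home c)
    ... | refl = a , a∈in , c∈con

    kept⇒¬carried : ∀ {c x y} → c ∈ proj₁ (M x) × ¬ Moved x c → ¬ Carried y c
    kept⇒¬carried {c} (c∈Mx , ¬moved) carried with M-unique c∈Mx (∈home c)
    ... | refl = ¬moved (carried⇒moved-from-home carried)

    carried-unique : ∀ {c x y} → Carried x c → Carried y c → x ≡ y
    carried-unique {x = x} {y} (a , y₁ , a∈out , a∈in , c∈con-a) (b , y₂ , b∈out , _ , c∈con-b)
      with x ≟ y
    ... | yes x≡y = x≡y
    ... | no x≢y with M-unique (InConA⇒∈ (closed y₁) c∈con-a) (InConA⇒∈ (closed y₂) c∈con-b)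
    ...   | refl =
      contradiction (InConA-shared (closed y₁) (inputs-present y₁ a a∈in) c∈con-a c∈con-b)
                    (outputs-unlinked a b x y a∈out b∈out x≢y y₁ (inj₁ (a , inj₁ a∈in)))

    M'-unique : ∀ {c x y} → c ∈ proj₁ (M' x) → c ∈ proj₁ (M' y) → x ≡ y
    M'-unique c∈M'x c∈M'y with ∈M'⇒kept⊎carried c∈M'x | ∈M'⇒kept⊎carried c∈M'y
    ... | inj₁ (c∈Mx , _)  | inj₁ (c∈My , _) = M-unique c∈Mx c∈My
    ... | inj₁ kept        | inj₂ carried    = contradiction carried (kept⇒¬carried kept)
    ... | inj₂ carried     | inj₁ kept       = contradiction carried (kept⇒¬carried kept)
    ... | inj₂ carried₁    | inj₂ carried₂   = carried-unique carried₁ carried₂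

    placesOfBase-M'-nonempty : ∀ c → Nonempty (placesOfBase N M' c)
    placesOfBase-M'-nonempty c = nonempty-by-cases byCases
      where
      byCases : Dec (Moved (home c) c) → Nonempty (placesOfBase N M' c)
      byCases (yes (a , a∈in , c∈con)) with to (output-base a) (home c , a∈in)
      ... | y , a∈out = y , ∈-tabulate-lookup⁺ (proj₁ ∘ M')
                              (from (base-update y c) (inj₂ (inj₂ (a , home c , a∈out , a∈in , c∈con))))
      byCases (no ¬moved) =
        home c , ∈-tabulate-lookup⁺ (proj₁ ∘ M') (from (base-update (home c) c) (inj₁ (∈home c , ¬moved)))

    placesOfBase-M'-atMostOne : ∀ c → AtMostOne (placesOfBase N M' c)
    placesOfBase-M'-atMostOne c x∈ y∈ =
      M'-unique (∈-tabulate-lookup⁻ (proj₁ ∘ M') x∈) (∈-tabulate-lookup⁻ (proj₁ ∘ M') y∈)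

    placesOfBase-forward : ∀ c → ∣ placesOfBase N M' c ∣ ≡ 1
    placesOfBase-forward c =
      nonempty∧atMostOne⇒∣p∣≡1 (placesOfBase-M'-nonempty c) (placesOfBase-M'-atMostOne c)

    bond-start-∈M' : ∀ {x β} → β ∈ proj₂ (M' x) → proj₁ (ends N β) ∈ proj₁ (M' x)
    bond-start-∈M' {x} {β} β∈M'x with to (bond-update x β) β∈M'x
    ... | inj₁ (β∈Mx , ¬moved) = from (base-update x _) (inj₁ (proj₁ (closed x β β∈Mx) ,
          λ (a , a∈in , start∈con) → ¬moved (a , a∈in , InConA-start⇒InConB (closed x) β∈Mx start∈con)))
    ... | inj₂ (inj₁ β∈out) =
          from (base-update x _) (inj₂ (inj₁ (output-bond-start x β β∈out)))
    ... | inj₂ (inj₂ (a , y , a∈out , a∈in , β∈con)) =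
          from (base-update x _) (inj₂ (inj₂ (a , y , a∈out , a∈in , InConB⇒InConA-start β∈con)))

    bond-persists : ∀ {β x} → β ∈ proj₂ (M x) → Nonempty (placesOfBond N M' β)
    bond-persists {β} {x} β∈Mx = nonempty-by-cases byCases
      where
      byCases : Dec (MovedBond x β) → Nonempty (placesOfBond N M' β)
      byCases (yes (a , a∈in , β∈con)) with to (output-base a) (x , a∈in)
      ... | y , a∈out = y , ∈-tabulate-lookup⁺ (proj₂ ∘ M')
                              (from (bond-update y β) (inj₂ (inj₂ (a , x , a∈out , a∈in , β∈con))))
      byCases (no ¬moved) =
        x , ∈-tabulate-lookup⁺ (proj₂ ∘ M') (from (bond-update x β) (inj₁ (β∈Mx , ¬moved)))

    placesOfBond-forward : ∀ β →
      ∣ placesOfBond N M β ∣ ≤ ∣ placesOfBond N M' β ∣ × ∣ placesOfBond N M' β ∣ ≤ 1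
    placesOfBond-forward β =
        atMostOne⇒∣p∣≤∣q∣ placesOfBond-M-atMostOne (bond-persists ∘ ∈-tabulate-lookup⁻ (proj₂ ∘ M))
      , atMostOne⇒∣p∣≤1 placesOfBond-M'-atMostOne
      where
      placesOfBond-M-atMostOne : AtMostOne (placesOfBond N M β)
      placesOfBond-M-atMostOne =
        atMostOne-⊆ (placesOfBond⊆placesOfBase M λ {x} β∈ → proj₁ (closed x _ β∈))
                    (∣p∣≡1⇒atMostOne (unique _))

      placesOfBond-M'-atMostOne : AtMostOne (placesOfBond N M' β)
      placesOfBond-M'-atMostOne =
        atMostOne-⊆ (placesOfBond⊆placesOfBase M' bond-start-∈M') (placesOfBase-M'-atMostOne _)

proposition3p1 : (N : RPN) → IsRPN N → WellFormed N →
    (M M' : Marking N) (H H' : History N) (t : Fin (nT N)) →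
    IsMarking N M →
    (∀ (a : Fin (nA N)) → ∣ placesOfBase N M a ∣ ≡ 1) →
    ForwardStep N M H t M' H' →
    (∀ (a : Fin (nA N)) → ∣ placesOfBase N M' a ∣ ≡ 1)
    × (∀ (β : Fin (nB N)) →
         ∣ placesOfBond N M β ∣ ≤ ∣ placesOfBond N M' β ∣ × ∣ placesOfBond N M' β ∣ ≤ 1)
proposition3p1 N rpn wf M M' H H' t closed unique fire =
    placesOfBase-forward N rpn wf closed unique fire
  , placesOfBond-forward N rpn wf closed unique fire
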